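{- Let $H$ be an $l$-meager hypergraph and $X$ a nonempty vertex set of cardinality $k\leq l$. Then the closure $\overline{X}$ satisfies $\|\overline{X}\|<2k$.
   Context: A hypergraph is a pair $H=(U,T)$ with $U$ a finite nonempty vertex set and $T$ a collection of 3-element subsets of $U$ (hyperedges). For nonempty $X\subseteq U$, $\|X\|$ is its cardinality and $[X]$ the number of hyperedges contained in $X$; $X$ is dense if $\|X\|\le2[X]$; $H$ is $l$-meager if it has no dense vertex sets of cardinality $\le 2l$. A vertex set $X$ attracts a vertex $y$ if there are $x_1,x_2\in X$ with $\{x_1,x_2,y\}\in T$. $X$ is closed if it contains every vertex it attracts; the closure $\overline{X}$ is the least closed set containing $X$. -}

module Defs where

open import Data.Nat using (ℕ; _≤_; _*_)
open import Data.Fin using (Fin)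
open import Data.Fin.Subset using (Subset; _⊆_; _∈_; _∪_; ⁅_⁆; ∣_∣; Nonempty)
open import Data.Fin.Subset.Properties using (_⊆?_)
open import Data.List using (List; length; filter)
open import Data.List.Membership.Propositional renaming (_∈_ to _∈ˡ_)
open import Data.List.Relation.Unary.All using (All)
open import Data.List.Relation.Unary.Unique.Propositional using (Unique)
open import Data.Product using (∃; ∃₂; _×_)
open import Relation.Binary.PropositionalEquality using (_≡_)
open import Relation.Nullary using (¬_)

record Hypergraph (n : ℕ) : Set where
  field
    edges      : List (Subset n)
    edges-size : All (λ e → ∣ e ∣ ≡ 3) edges
    edges-uniq : Unique edges
open Hypergraph public

module _ {n : ℕ} (H : Hypergraph n) where

  ⟦_⟧ : Subset n → ℕ
  ⟦ X ⟧ = length (filter (_⊆? X) (edges H))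

  Dense : Subset n → Set
  Dense X = ∣ X ∣ ≤ 2 * ⟦ X ⟧

  Meager : ℕ → Set
  Meager l = ∀ (X : Subset n) → Nonempty X → ∣ X ∣ ≤ 2 * l → ¬ Dense X

  Attracts : Subset n → Fin n → Set
  Attracts X y = ∃₂ λ x₁ x₂ → x₁ ∈ X × x₂ ∈ X × (⁅ x₁ ⁆ ∪ ⁅ x₂ ⁆ ∪ ⁅ y ⁆) ∈ˡ edges H

  Closed : Subset n → Set
  Closed X = ∀ y → Attracts X y → y ∈ X

  IsClosure : Subset n → Subset n → Set
  IsClosure X C = X ⊆ C × Closed C × (∀ D → X ⊆ D → Closed D → C ⊆ D)

-- Starting from X, keep adjoining a vertex that the current set attracts. Inside the
-- closure C this is possible as long as the current set is smaller than C, since a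
-- closed set between X and C must contain C; each step adds one vertex and at least
-- one hyperedge. So if ‖C‖ ≥ 2k, after k steps we reach a set of 2k ≤ 2l vertices
-- containing at least k hyperedges: a small dense set, contradicting meagerness.
module Submission where

open import Defs
open import Data.Bool using () renaming (_≟_ to _≟ᵇ_)
open import Data.Empty using (⊥-elim)
open import Data.Fin using (Fin; zero; suc)
open import Data.Fin.Properties using (any?)
open import Data.Fin.Subset
  using (Subset; ∣_∣; Nonempty; _⊆_; _∈_; _∉_; _∪_; ⁅_⁆; inside; outside)
open import Data.Fin.Subset.Properties
  using (_⊆?_; _∈?_; ⊆-refl; ⊆-trans; p⊆q⇒∣p∣≤∣q∣; x∈⁅x⁆; x∈⁅y⁆⇒x≡y; p⊆p∪q; q⊆p∪q;
         x∈p∪q⁻; ∪-identityˡ)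
open import Data.List using ([]; _∷_; length; filter)
open import Data.List.Membership.Propositional using () renaming (_∈_ to _∈ˡ_)
open import Data.List.Membership.Propositional.Properties using (∈-filter⁺)
open import Data.List.Properties using (filter-notAll; filter-accept; filter-reject)
open import Data.List.Relation.Unary.Any using () renaming (map to mapAny)
open import Data.Nat using (ℕ; zero; suc; _≤_; _<_; _*_; _+_; z≤n; s≤s; _<?_)
open import Data.Nat.Properties
  using (+-identityʳ; +-suc; ≤-trans; <⇒≤; <⇒≱; ≮⇒≥; *-monoʳ-≤)
open import Data.Product using (∃; _×_; _,_)
open import Data.Sum using (_⊎_; inj₁; inj₂; [_,_]′)
open import Data.Vec using (_∷_; here; there)
open import Data.Vec.Properties using (≡-dec)
open import Function using (_∘_)
open import Relation.Binary.PropositionalEquality using (_≡_; refl; sym; trans; cong; subst)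
open import Relation.Nullary using (¬_; yes; no; ¬?; _×-dec_)
open import Relation.Nullary.Decidable using (decidable-stable)
open import Relation.Unary using (Pred; Decidable)
import Data.List.Membership.DecPropositional as DecMembership

module _ {a p q} {A : Set a} {P : Pred A p} {Q : Pred A q}
         (P? : Decidable P) (Q? : Decidable Q) (P⇒Q : ∀ {x} → P x → Q x) where

  filter-filter-⊆ : ∀ xs → filter P? (filter Q? xs) ≡ filter P? xs
  filter-filter-⊆ [] = refl
  filter-filter-⊆ (x ∷ xs) with Q? x | P? x
  ... | yes _ | yes px = trans (filter-accept P? px) (cong (x ∷_) (filter-filter-⊆ xs))
  ... | yes _ | no ¬px = trans (filter-reject P? ¬px) (filter-filter-⊆ xs)
  ... | no ¬qx | yes px = ⊥-elim (¬qx (P⇒Q px))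
  ... | no _  | no _   = filter-filter-⊆ xs

  length-filter-< : ∀ {x} xs → x ∈ˡ xs → Q x → ¬ P x →
                    length (filter P? xs) < length (filter Q? xs)
  length-filter-< xs x∈xs qx ¬px =
    subst (_< length (filter Q? xs)) (cong length (filter-filter-⊆ xs))
      (filter-notAll P? (filter Q? xs) (mapAny (λ { refl → ¬px }) (∈-filter⁺ Q? x∈xs qx)))

∣⁅x⁆∪p∣≡1+∣p∣ : ∀ {n} {x : Fin n} {p : Subset n} → x ∉ p → ∣ ⁅ x ⁆ ∪ p ∣ ≡ suc ∣ p ∣
∣⁅x⁆∪p∣≡1+∣p∣ {x = zero}  {outside ∷ p} _   = cong (suc ∘ ∣_∣) (∪-identityˡ p)
∣⁅x⁆∪p∣≡1+∣p∣ {x = zero}  {inside ∷ p}  x∉p = ⊥-elim (x∉p here)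
∣⁅x⁆∪p∣≡1+∣p∣ {x = suc x} {outside ∷ p} x∉p = ∣⁅x⁆∪p∣≡1+∣p∣ (x∉p ∘ there)
∣⁅x⁆∪p∣≡1+∣p∣ {x = suc x} {inside ∷ p}  x∉p = cong suc (∣⁅x⁆∪p∣≡1+∣p∣ (x∉p ∘ there))

module _ {n : ℕ} {p q r : Subset n} where

  ∪-lub : p ⊆ r → q ⊆ r → p ∪ q ⊆ r
  ∪-lub p⊆r q⊆r x∈p∪q = [ p⊆r , q⊆r ]′ (x∈p∪q⁻ p q x∈p∪q)

x∈p⇒⁅x⁆⊆p : ∀ {n} {x : Fin n} {p : Subset n} → x ∈ p → ⁅ x ⁆ ⊆ p
x∈p⇒⁅x⁆⊆p {p = p} x∈p y∈⁅x⁆ = subst (_∈ p) (sym (x∈⁅y⁆⇒x≡y _ y∈⁅x⁆)) x∈p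

module _ {n : ℕ} (H : Hypergraph n) where

  open DecMembership (≡-dec {n = n} _≟ᵇ_) using () renaming (_∈?_ to _∈ˡ?_)

  attracts? : ∀ X → Decidable (Attracts H X)
  attracts? X y = any? λ x₁ → any? λ x₂ →
    x₁ ∈? X ×-dec x₂ ∈? X ×-dec (⁅ x₁ ⁆ ∪ ⁅ x₂ ⁆ ∪ ⁅ y ⁆) ∈ˡ? edges H

  closed-or-escapes : ∀ X → Closed H X ⊎ ∃ λ y → Attracts H X y × y ∉ X
  closed-or-escapes X with any? (λ y → attracts? X y ×-dec ¬? (y ∈? X))
  ... | yes escape  = inj₂ escape
  ... | no ¬escape = inj₁ λ y a → decidable-stable (y ∈? X) λ y∉X → ¬escape (y , a , y∉X)

  attracts-mono : ∀ {Y Z y} → Y ⊆ Z → Attracts H Y y → Attracts H Z y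
  attracts-mono Y⊆Z (x₁ , x₂ , x₁∈Y , x₂∈Y , e∈T) = x₁ , x₂ , Y⊆Z x₁∈Y , Y⊆Z x₂∈Y , e∈T

  ⟦⟧-adjoin-attracted : ∀ {Y y} → Attracts H Y y → y ∉ Y → suc (⟦_⟧ H Y) ≤ ⟦_⟧ H (⁅ y ⁆ ∪ Y)
  ⟦⟧-adjoin-attracted {Y} {y} (x₁ , x₂ , x₁∈Y , x₂∈Y , e∈T) y∉Y =
    length-filter-< (_⊆? Y) (_⊆? (⁅ y ⁆ ∪ Y)) (q⊆p∪q ⁅ y ⁆ Y ∘_) (edges H) e∈T e⊆Y+y e⊈Y
    where
    e⊆Y+y : ⁅ x₁ ⁆ ∪ ⁅ x₂ ⁆ ∪ ⁅ y ⁆ ⊆ ⁅ y ⁆ ∪ Y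
    e⊆Y+y = ∪-lub (q⊆p∪q ⁅ y ⁆ Y ∘ x∈p⇒⁅x⁆⊆p x₁∈Y)
              (∪-lub (q⊆p∪q ⁅ y ⁆ Y ∘ x∈p⇒⁅x⁆⊆p x₂∈Y) (p⊆p∪q Y))
    e⊈Y : ¬ (⁅ x₁ ⁆ ∪ ⁅ x₂ ⁆ ∪ ⁅ y ⁆ ⊆ Y)
    e⊈Y e⊆Y = y∉Y (e⊆Y (q⊆p∪q ⁅ x₁ ⁆ _ (q⊆p∪q ⁅ x₂ ⁆ ⁅ y ⁆ (x∈⁅x⁆ y))))

  closure-escapes : ∀ {X Y C} → IsClosure H X C → X ⊆ Y → ∣ Y ∣ < ∣ C ∣ →
                    ∃ λ y → Attracts H Y y × y ∉ Y
  closure-escapes {Y = Y} (_ , _ , least) X⊆Y ∣Y∣<∣C∣ with closed-or-escapes Y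
  ... | inj₁ Y-closed = ⊥-elim (<⇒≱ ∣Y∣<∣C∣ (p⊆q⇒∣p∣≤∣q∣ (least Y X⊆Y Y-closed)))
  ... | inj₂ escape   = escape

  closure-adjoin : ∀ {X Y C} → IsClosure H X C → X ⊆ Y → Y ⊆ C → ∣ Y ∣ < ∣ C ∣ →
                   ∃ λ Z → Y ⊆ Z × Z ⊆ C × ∣ Z ∣ ≡ suc ∣ Y ∣ × suc (⟦_⟧ H Y) ≤ ⟦_⟧ H Z
  closure-adjoin {Y = Y} clo@(_ , C-closed , _) X⊆Y Y⊆C ∣Y∣<∣C∣
    with y , Y→y , y∉Y ← closure-escapes clo X⊆Y ∣Y∣<∣C∣
    = ⁅ y ⁆ ∪ Y
    , q⊆p∪q ⁅ y ⁆ Y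
    , ∪-lub (x∈p⇒⁅x⁆⊆p (C-closed y (attracts-mono Y⊆C Y→y))) Y⊆C
    , ∣⁅x⁆∪p∣≡1+∣p∣ y∉Y
    , ⟦⟧-adjoin-attracted Y→y y∉Y

  closure-chain : ∀ {X C} → IsClosure H X C → ∀ j → ∣ X ∣ + j ≤ ∣ C ∣ →
                  ∃ λ Y → X ⊆ Y × Y ⊆ C × ∣ Y ∣ ≡ ∣ X ∣ + j × j ≤ ⟦_⟧ H Y
  closure-chain {X} (X⊆C , _) zero _ = X , ⊆-refl , X⊆C , sym (+-identityʳ ∣ X ∣) , z≤n
  closure-chain {X} {C} clo (suc j) ∣X∣+1+j≤∣C∣ =
    let ∣X∣+j<∣C∣ = subst (_≤ ∣ C ∣) (+-suc ∣ X ∣ j) ∣X∣+1+j≤∣C∣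
        Y , X⊆Y , Y⊆C , ∣Y∣≡∣X∣+j , j≤⟦Y⟧ = closure-chain clo j (<⇒≤ ∣X∣+j<∣C∣)
        Z , Y⊆Z , Z⊆C , ∣Z∣≡1+∣Y∣ , ⟦Y⟧<⟦Z⟧ =
          closure-adjoin clo X⊆Y Y⊆C (subst (_< ∣ C ∣) (sym ∣Y∣≡∣X∣+j) ∣X∣+j<∣C∣)
    in Z , ⊆-trans X⊆Y Y⊆Z , Z⊆C
     , trans ∣Z∣≡1+∣Y∣ (trans (cong suc ∣Y∣≡∣X∣+j) (sym (+-suc ∣ X ∣ j)))
     , ≤-trans (s≤s j≤⟦Y⟧) ⟦Y⟧<⟦Z⟧

lemma2p4p1 : ∀ {n : ℕ} (H : Hypergraph (suc n)) (l k : ℕ) → Meager H l →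
    (X : Subset (suc n)) → Nonempty X → ∣ X ∣ ≡ k → k ≤ l →
    (C : Subset (suc n)) → IsClosure H X C → ∣ C ∣ < 2 * k
lemma2p4p1 H l k meager X (x , x∈X) refl k≤l C clo with ∣ C ∣ <? 2 * k
... | yes ∣C∣<2k = ∣C∣<2k
... | no ∣C∣≮2k =
  let 2k≡k+k : 2 * k ≡ k + k
      2k≡k+k = cong (k +_) (+-identityʳ k)
      Y , X⊆Y , _ , ∣Y∣≡k+k , k≤⟦Y⟧ = closure-chain H clo k (subst (_≤ ∣ C ∣) 2k≡k+k (≮⇒≥ ∣C∣≮2k))
      ∣Y∣≡2k = trans ∣Y∣≡k+k (sym 2k≡k+k)
  in ⊥-elim (meager Y (x , X⊆Y x∈X) (subst (_≤ 2 * l) (sym ∣Y∣≡2k) (*-monoʳ-≤ 2 k≤l))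
       (subst (_≤ 2 * ⟦_⟧ H Y) (sym ∣Y∣≡2k) (*-monoʳ-≤ 2 k≤⟦Y⟧)))
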